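{- For a colored graph $G=(V(G),E(G),c_G)$ define the colored graph $G_{\mathcal{M}}$ with vertex set $V(G)\cup\mathcal{M}(G)$, edge set $\{vC\mid C\in\mathcal{M}(G),v\in C\}\cup\{vw\mid v\neq w\in V(G)\}\cup\{CD\mid C\neq D\in\mathcal{M}(G)\}$, and coloring $v\mapsto c_G(v)+1$ for $v\in V(G)$ and $C\mapsto1$ for $C\in\mathcal{M}(G)$. Then for all colored graphs $G$ and $H$: (1) $G\cong H$ if and only if $G_{\mathcal{M}}\cong H_{\mathcal{M}}$; (2) the pointwise stabilizer of $V(G)$ in $\mathrm{Aut}(G_{\mathcal{M}})$ is trivial, i.e. $\{\gamma\in\mathrm{Aut}(G_{\mathcal{M}})\mid \gamma(v)=v\ \forall v\in V(G)\}=\{1\}$; (3) $\mathrm{Aut}(G_{\mathcal{M}})|_{V(G)}=\mathrm{Aut}(G)$.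
   Context: $\mathcal{M}(G)$ is the set of maximal cliques of $G$. Isomorphisms and automorphisms of colored graphs preserve colors. Colors take values in $\mathbb{N}=\{1,2,\dots\}$. For a group acting on a set with an invariant subset $A$, $\Gamma|_A=\{\gamma|_A\mid\gamma\in\Gamma\}$ (well defined since $V(G)$ is $\mathrm{Aut}(G_{\mathcal{M}})$-invariant by the coloring). -}

module Defs where

open import Data.Nat using (ℕ; suc; _≤_)
open import Data.Bool using (Bool; true; false)
open import Data.Bool.Properties using () renaming (_≟_ to _≟ᵇ_)
open import Data.Fin using (Fin)
open import Data.Fin.Properties using (all?) renaming (_≟_ to _≟ᶠ_)
open import Data.Fin.Subset using (Subset; _∈_; _⊂_)
open import Data.Fin.Subset.Properties using (_∈?_; _⊂?_; anySubset?)
open import Data.Product using (Σ; ∃; _×_; _,_; proj₁)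
open import Data.Sum using (_⊎_; inj₁; inj₂)
open import Function.Bundles using (Inverse)
open import Relation.Binary.PropositionalEquality using (_≡_; _≢_; setoid)
open import Relation.Nullary using (Dec; ¬_; _×-dec_; ¬?)
open import Relation.Nullary.Decidable using (True; _→-dec_)

record ColoredGraph (n : ℕ) : Set where
  field
    adj       : Fin n → Fin n → Bool
    adj-sym   : ∀ u v → adj u v ≡ adj v u
    adj-irrefl : ∀ v → adj v v ≡ false
    color     : Fin n → ℕ
    color-pos : ∀ v → 1 ≤ color v
open ColoredGraph public

IsClique : ∀ {n} → ColoredGraph n → Subset n → Set
IsClique G C = ∀ u v → u ∈ C → v ∈ C → u ≢ v → adj G u v ≡ true

isClique? : ∀ {n} (G : ColoredGraph n) (C : Subset n) → Dec (IsClique G C)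
isClique? G C = all? λ u → all? λ v →
  (u ∈? C) →-dec ((v ∈? C) →-dec (¬? (u ≟ᶠ v) →-dec (adj G u v ≟ᵇ true)))

IsMaximalClique : ∀ {n} → ColoredGraph n → Subset n → Set
IsMaximalClique G C = IsClique G C × ¬ (∃ λ D → IsClique G D × C ⊂ D)

isMaximalClique? : ∀ {n} (G : ColoredGraph n) (C : Subset n) → Dec (IsMaximalClique G C)
isMaximalClique? G C =
  isClique? G C ×-dec ¬? (anySubset? (λ D → isClique? G D ×-dec (C ⊂? D)))

-- 𝓜(G): the set of maximal cliques.  The proof component is the
-- proof-irrelevant 'True' of the decision, so elements are determined by
-- the underlying subset.
MaxClique : ∀ {n} → ColoredGraph n → Set
MaxClique G = Σ (Subset _) (λ C → True (isMaximalClique? G C))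

record CGraph : Set₁ where
  field
    Vtx : Set
    E   : Vtx → Vtx → Set
    col : Vtx → ℕ
open CGraph public

record Iso (A B : CGraph) : Set where
  field
    bij      : Inverse (setoid (Vtx A)) (setoid (Vtx B))
  open Inverse bij public using (to; from)
  field
    edge-pres : ∀ x y → E A x y → E B (to x) (to y)
    edge-refl : ∀ x y → E B (to x) (to y) → E A x y
    col-pres  : ∀ x → col B (to x) ≡ col A x
open Iso public

Aut : CGraph → Set
Aut A = Iso A A

⟦_⟧ : ∀ {n} → ColoredGraph n → CGraph
⟦_⟧ {n} G = record
  { Vtx = Fin n
  ; E   = λ u v → adj G u v ≡ true
  ; col = color G
  }

GM-E : ∀ {n} (G : ColoredGraph n) → Fin n ⊎ MaxClique G → Fin n ⊎ MaxClique G → Set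
GM-E G (inj₁ v) (inj₁ w) = v ≢ w
GM-E G (inj₁ v) (inj₂ C) = v ∈ proj₁ C
GM-E G (inj₂ C) (inj₁ v) = v ∈ proj₁ C
GM-E G (inj₂ C) (inj₂ D) = proj₁ C ≢ proj₁ D

GM-col : ∀ {n} (G : ColoredGraph n) → Fin n ⊎ MaxClique G → ℕ
GM-col G (inj₁ v) = suc (color G v)
GM-col G (inj₂ C) = 1

GM : ∀ {n} → ColoredGraph n → CGraph
GM {n} G = record
  { Vtx = Fin n ⊎ MaxClique G
  ; E   = GM-E G
  ; col = GM-col G
  }

-- The colouring of G_𝓜 gives exactly the clique nodes colour 1, so an
-- isomorphism G_𝓜 ≅ H_𝓜 restricts to a bijection V(G) → V(H).  It preserves
-- edges because every edge uv lies in a maximal clique C, and the image of C is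
-- a maximal clique of H adjacent to the images of u and v; by symmetry it
-- reflects them too.  Conversely an isomorphism G ≅ H maps maximal cliques to
-- maximal cliques and so extends to G_𝓜 ≅ H_𝓜.  A clique node is determined
-- by its neighbourhood in V(G), hence an automorphism of G_𝓜 fixing V(G)
-- pointwise is the identity.
module Submission where

open import Defs
open import Data.Nat using (suc; s≤s)
open import Data.Nat.Properties using (<⇒≢; suc-injective)
open import Data.Bool using (true)
open import Data.Bool.Properties using (T-irrelevant)
open import Data.Empty using (⊥-elim)
open import Data.Fin using (Fin)
open import Data.Fin.Subset using (Subset; _∈_; _⊆_; _⊂_; _⊃_; _∪_; ⁅_⁆)
open import Data.Fin.Subset.Properties
  using (anySubset?; _⊂?_; ⊆-trans; ⊆-antisym; x∈p∪q⁺; x∈p∪q⁻; x∈⁅x⁆; x∈⁅y⁆⇒x≡y)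
open import Data.Fin.Subset.Induction using (Acc; acc; ⊃-wellFounded)
open import Data.Product using (Σ; ∃; _×_; _,_; proj₁; proj₂)
open import Data.Sum using (_⊎_; inj₁; inj₂; map)
open import Data.Sum.Properties using (inj₁-injective)
open import Data.Vec using (tabulate; lookup)
open import Data.Vec.Properties using ([]=⇒lookup; lookup⇒[]=; lookup∘tabulate)
open import Function using (_∘_)
open import Function.Bundles using (Inverse; mk↔ₛ′)
open import Function.Properties.Inverse using (↔-sym)
open import Relation.Binary.PropositionalEquality
  using (_≡_; _≢_; refl; sym; trans; cong; subst; subst₂; module ≡-Reasoning)
open import Relation.Nullary using (yes; no; _×-dec_)
open import Relation.Nullary.Decidable using (fromWitness; toWitness)

module _ {A B : CGraph} (γ : Iso A B) where

  to∘from : ∀ y → to γ (from γ y) ≡ y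
  to∘from = Inverse.strictlyInverseˡ (bij γ)

  from∘to : ∀ x → from γ (to γ x) ≡ x
  from∘to = Inverse.strictlyInverseʳ (bij γ)

  to-injective : ∀ {x y} → to γ x ≡ to γ y → x ≡ y
  to-injective {x} {y} eq = begin
    x                 ≡⟨ sym (from∘to x) ⟩
    from γ (to γ x)   ≡⟨ cong (from γ) eq ⟩
    from γ (to γ y)   ≡⟨ from∘to y ⟩
    y                 ∎
    where open ≡-Reasoning

  Iso-sym : Iso B A
  Iso-sym = record
    { bij       = ↔-sym (bij γ)
    ; edge-pres = λ x y e →
        edge-refl γ (from γ x) (from γ y) (subst₂ (E B) (sym (to∘from x)) (sym (to∘from y)) e)
    ; edge-refl = λ x y e → subst₂ (E B) (to∘from x) (to∘from y) (edge-pres γ _ _ e)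
    ; col-pres  = λ y → trans (sym (col-pres γ (from γ y))) (cong (col B) (to∘from y))
    }

x∈⁅u⁆∪⁅v⁆ : ∀ {n} {x u v : Fin n} → x ∈ ⁅ u ⁆ ∪ ⁅ v ⁆ → x ≡ u ⊎ x ≡ v
x∈⁅u⁆∪⁅v⁆ {u = u} {v} = map (x∈⁅y⁆⇒x≡y u) (x∈⁅y⁆⇒x≡y v) ∘ x∈p∪q⁻ ⁅ u ⁆ ⁅ v ⁆

module _ {n} (G : ColoredGraph n) where

  MaxClique-≡ : {C D : MaxClique G} → proj₁ C ≡ proj₁ D → C ≡ D
  MaxClique-≡ {C , p} {.C , q} refl = cong (C ,_) (T-irrelevant p q)

  maxClique⇒clique : (C : MaxClique G) → IsClique G (proj₁ C)
  maxClique⇒clique (C , p) = proj₁ (toWitness {a? = isMaximalClique? G C} p)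

  clique⊆maxClique : ∀ {C} → IsClique G C → Σ (MaxClique G) (λ M → C ⊆ proj₁ M)
  clique⊆maxClique {C} = go (⊃-wellFounded C)
    where
    go : ∀ {C} → Acc _⊃_ C → IsClique G C → Σ (MaxClique G) (λ M → C ⊆ proj₁ M)
    go {C} (acc larger) cl with anySubset? (λ D → isClique? G D ×-dec (C ⊂? D))
    ... | no ∄larger = (C , fromWitness (cl , ∄larger)) , λ x∈C → x∈C
    ... | yes (D , clD , C⊂D) with go (larger C⊂D) clD
    ...   | M , D⊆M = M , ⊆-trans (proj₁ C⊂D) D⊆M

  edge⇒clique : ∀ {u v} → adj G u v ≡ true → IsClique G (⁅ u ⁆ ∪ ⁅ v ⁆)
  edge⇒clique {u} {v} uv x y x∈ y∈ x≢y with x∈⁅u⁆∪⁅v⁆ x∈ | x∈⁅u⁆∪⁅v⁆ y∈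
  ... | inj₁ refl | inj₁ refl = ⊥-elim (x≢y refl)
  ... | inj₂ refl | inj₂ refl = ⊥-elim (x≢y refl)
  ... | inj₁ refl | inj₂ refl = uv
  ... | inj₂ refl | inj₁ refl = trans (adj-sym G v u) uv

  edge⇒maxClique : ∀ {u v} → adj G u v ≡ true → Σ (MaxClique G) (λ M → u ∈ proj₁ M × v ∈ proj₁ M)
  edge⇒maxClique {u} {v} uv with clique⊆maxClique (edge⇒clique uv)
  ... | M , ⊆M = M , ⊆M (x∈p∪q⁺ (inj₁ (x∈⁅x⁆ u))) , ⊆M (x∈p∪q⁺ (inj₂ (x∈⁅x⁆ v)))

  adj⇒≢ : ∀ {u v} → adj G u v ≡ true → u ≢ v
  adj⇒≢ {u} uv refl with trans (sym uv) (adj-irrefl G u)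
  ... | ()

preimage : ∀ {n m} → (Fin m → Fin n) → Subset n → Subset m
preimage h S = tabulate (λ w → lookup S (h w))

module _ {n m} (h : Fin m → Fin n) (S : Subset n) where

  ∈-preimage⁺ : ∀ {w} → h w ∈ S → w ∈ preimage h S
  ∈-preimage⁺ {w} hw∈S =
    lookup⇒[]= w (preimage h S) (trans (lookup∘tabulate (lookup S ∘ h) w) ([]=⇒lookup hw∈S))

  ∈-preimage⁻ : ∀ {w} → w ∈ preimage h S → h w ∈ S
  ∈-preimage⁻ {w} w∈ =
    lookup⇒[]= (h w) S (trans (sym (lookup∘tabulate (lookup S ∘ h) w)) ([]=⇒lookup w∈))

preimage-cancel : ∀ {n m} (h : Fin m → Fin n) (k : Fin n → Fin m) →
                  (∀ x → h (k x) ≡ x) → ∀ S → preimage k (preimage h S) ≡ S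
preimage-cancel h k hk S = ⊆-antisym
  (λ {x} x∈ → subst (_∈ S) (hk x) (∈-preimage⁻ h S (∈-preimage⁻ k (preimage h S) x∈)))
  (λ {x} x∈ → ∈-preimage⁺ k (preimage h S) (∈-preimage⁺ h S (subst (_∈ S) (sym (hk x)) x∈)))

-- The graphs are explicit module parameters throughout: ⟦_⟧ and GM forget
-- the proof fields of a ColoredGraph, so it cannot be inferred from the type
-- of an isomorphism.
module Image {n m} (G : ColoredGraph n) (H : ColoredGraph m) (σ : Iso ⟦ G ⟧ ⟦ H ⟧) where

  image : Subset n → Subset m
  image = preimage (from σ)

  ∈-image⁺ : ∀ {S v} → v ∈ S → to σ v ∈ image S
  ∈-image⁺ {S} {v} v∈S = ∈-preimage⁺ (from σ) S (subst (_∈ S) (sym (from∘to σ v)) v∈S)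

  ∈-image⁻ : ∀ {S v} → to σ v ∈ image S → v ∈ S
  ∈-image⁻ {S} {v} v∈ = subst (_∈ S) (from∘to σ v) (∈-preimage⁻ (from σ) S v∈)

  preimage-image : ∀ S → preimage (to σ) (image S) ≡ S
  preimage-image = preimage-cancel (from σ) (to σ) (from∘to σ)

  image-preimage : ∀ D → image (preimage (to σ) D) ≡ D
  image-preimage = preimage-cancel (to σ) (from σ) (to∘from σ)

  image-⊂ : ∀ {S T} → S ⊂ T → image S ⊂ image T
  image-⊂ {S} {T} (S⊆T , x , x∈T , x∉S) =
      (λ {y} y∈ → ∈-preimage⁺ (from σ) T (S⊆T (∈-preimage⁻ (from σ) S y∈)))
    , to σ x , ∈-image⁺ x∈T , x∉S ∘ ∈-image⁻

  clique-image : ∀ {S} → IsClique G S → IsClique H (image S)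
  clique-image {S} cl x y x∈ y∈ x≢y =
    edge-refl (Iso-sym σ) x y
      (cl (from σ x) (from σ y) (∈-preimage⁻ (from σ) S x∈) (∈-preimage⁻ (from σ) S y∈)
          (x≢y ∘ to-injective (Iso-sym σ)))

module MaxCliqueImage {n m} (G : ColoredGraph n) (H : ColoredGraph m) (σ : Iso ⟦ G ⟧ ⟦ H ⟧) where

  open Image G H σ
  private module σ⁻¹ = Image H G (Iso-sym σ)

  maxClique-image : ∀ {S} → IsMaximalClique G S → IsMaximalClique H (image S)
  maxClique-image {S} (cl , ∄larger) = clique-image cl , λ (D , clD , σS⊂D) →
    ∄larger ( σ⁻¹.image D , σ⁻¹.clique-image clD
            , subst (_⊂ σ⁻¹.image D) (preimage-image S) (σ⁻¹.image-⊂ σS⊂D))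

  MaxClique-image : MaxClique G → MaxClique H
  MaxClique-image (S , p) =
    image S , fromWitness (maxClique-image (toWitness {a? = isMaximalClique? G S} p))

  GM-to : Fin n ⊎ MaxClique G → Fin m ⊎ MaxClique H
  GM-to (inj₁ v) = inj₁ (to σ v)
  GM-to (inj₂ C) = inj₂ (MaxClique-image C)

module GM-Extension {n m} (G : ColoredGraph n) (H : ColoredGraph m) (σ : Iso ⟦ G ⟧ ⟦ H ⟧) where

  open Image G H σ
  open MaxCliqueImage G H σ
  private module σ⁻¹ = MaxCliqueImage H G (Iso-sym σ)

  GM-from∘to : ∀ x → σ⁻¹.GM-to (GM-to x) ≡ x
  GM-from∘to (inj₁ v)       = cong inj₁ (from∘to σ v)
  GM-from∘to (inj₂ (S , _)) = cong inj₂ (MaxClique-≡ G (preimage-image S))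

  GM-to∘from : ∀ y → GM-to (σ⁻¹.GM-to y) ≡ y
  GM-to∘from (inj₁ w)       = cong inj₁ (to∘from σ w)
  GM-to∘from (inj₂ (D , _)) = cong inj₂ (MaxClique-≡ H (image-preimage D))

  GM-to-edge-pres : ∀ x y → GM-E G x y → GM-E H (GM-to x) (GM-to y)
  GM-to-edge-pres (inj₁ u) (inj₁ v) u≢v = u≢v ∘ to-injective σ
  GM-to-edge-pres (inj₁ u) (inj₂ C) u∈C = ∈-image⁺ u∈C
  GM-to-edge-pres (inj₂ C) (inj₁ u) u∈C = ∈-image⁺ u∈C
  GM-to-edge-pres (inj₂ C) (inj₂ D) C≢D σC≡σD = C≢D (begin
    proj₁ C                                ≡⟨ sym (preimage-image (proj₁ C)) ⟩
    preimage (to σ) (image (proj₁ C))      ≡⟨ cong (preimage (to σ)) σC≡σD ⟩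
    preimage (to σ) (image (proj₁ D))      ≡⟨ preimage-image (proj₁ D) ⟩
    proj₁ D                                ∎)
    where open ≡-Reasoning

  GM-to-edge-refl : ∀ x y → GM-E H (GM-to x) (GM-to y) → GM-E G x y
  GM-to-edge-refl (inj₁ u) (inj₁ v) σu≢σv = σu≢σv ∘ cong (to σ)
  GM-to-edge-refl (inj₁ u) (inj₂ C) σu∈σC = ∈-image⁻ σu∈σC
  GM-to-edge-refl (inj₂ C) (inj₁ u) σu∈σC = ∈-image⁻ σu∈σC
  GM-to-edge-refl (inj₂ C) (inj₂ D) σC≢σD = σC≢σD ∘ cong image

  GM-to-col-pres : ∀ x → GM-col H (GM-to x) ≡ GM-col G x
  GM-to-col-pres (inj₁ v) = cong suc (col-pres σ v)
  GM-to-col-pres (inj₂ C) = refl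

  GM-map : Iso (GM G) (GM H)
  GM-map = record
    { bij       = mk↔ₛ′ GM-to σ⁻¹.GM-to GM-to∘from GM-from∘to
    ; edge-pres = GM-to-edge-pres
    ; edge-refl = GM-to-edge-refl
    ; col-pres  = GM-to-col-pres
    }

open GM-Extension using (GM-map)

module GM-Iso {n m} (G : ColoredGraph n) (H : ColoredGraph m) (γ : Iso (GM G) (GM H)) where

  vertex↦vertex : ∀ v → ∃ λ w → to γ (inj₁ v) ≡ inj₁ w
  vertex↦vertex v with to γ (inj₁ v) | col-pres γ (inj₁ v)
  ... | inj₁ w | _      = w , refl
  ... | inj₂ _ | 1≡1+cv = ⊥-elim (<⇒≢ (s≤s (color-pos G v)) 1≡1+cv)

  clique↦clique : ∀ C → ∃ λ D → to γ (inj₂ C) ≡ inj₂ D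
  clique↦clique C with to γ (inj₂ C) | col-pres γ (inj₂ C)
  ... | inj₂ D | _      = D , refl
  ... | inj₁ w | 1+cw≡1 = ⊥-elim (<⇒≢ (s≤s (color-pos H w)) (sym 1+cw≡1))

  restrict-to : Fin n → Fin m
  restrict-to v = proj₁ (vertex↦vertex v)

  to-inj₁ : ∀ v → to γ (inj₁ v) ≡ inj₁ (restrict-to v)
  to-inj₁ v = proj₂ (vertex↦vertex v)

  restrict-to-adj : ∀ u v → adj G u v ≡ true → adj H (restrict-to u) (restrict-to v) ≡ true
  restrict-to-adj u v uv with edge⇒maxClique G uv
  ... | C , u∈C , v∈C with clique↦clique C
  ...   | D , γC≡D = maxClique⇒clique H D (restrict-to u) (restrict-to v)
                       (γ-edge (inj₁ u) (inj₂ C) (to-inj₁ u) γC≡D u∈C)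
                       (γ-edge (inj₁ v) (inj₂ C) (to-inj₁ v) γC≡D v∈C)
                       (γ-edge (inj₁ u) (inj₁ v) (to-inj₁ u) (to-inj₁ v) (adj⇒≢ G uv))
    where
    γ-edge : ∀ x y {x′ y′} → to γ x ≡ x′ → to γ y ≡ y′ → GM-E G x y → GM-E H x′ y′
    γ-edge x y γx≡ γy≡ = subst₂ (GM-E H) γx≡ γy≡ ∘ edge-pres γ x y

  restrict-to-col : ∀ v → color H (restrict-to v) ≡ color G v
  restrict-to-col v =
    suc-injective (trans (cong (GM-col H) (sym (to-inj₁ v))) (col-pres γ (inj₁ v)))

module GM-Restriction {n m} (G : ColoredGraph n) (H : ColoredGraph m) (γ : Iso (GM G) (GM H)) where

  open GM-Iso G H γ
  private module γ⁻¹ = GM-Iso H G (Iso-sym γ)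

  restrict-from∘to : ∀ v → γ⁻¹.restrict-to (restrict-to v) ≡ v
  restrict-from∘to v = inj₁-injective (begin
    inj₁ (γ⁻¹.restrict-to (restrict-to v))  ≡⟨ sym (γ⁻¹.to-inj₁ (restrict-to v)) ⟩
    from γ (inj₁ (restrict-to v))           ≡⟨ cong (from γ) (sym (to-inj₁ v)) ⟩
    from γ (to γ (inj₁ v))                  ≡⟨ from∘to γ (inj₁ v) ⟩
    inj₁ v                                  ∎)
    where open ≡-Reasoning

  restrict-to∘from : ∀ w → restrict-to (γ⁻¹.restrict-to w) ≡ w
  restrict-to∘from w = inj₁-injective (begin
    inj₁ (restrict-to (γ⁻¹.restrict-to w))  ≡⟨ sym (to-inj₁ (γ⁻¹.restrict-to w)) ⟩
    to γ (inj₁ (γ⁻¹.restrict-to w))         ≡⟨ cong (to γ) (sym (γ⁻¹.to-inj₁ w)) ⟩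
    to γ (from γ (inj₁ w))                  ≡⟨ to∘from γ (inj₁ w) ⟩
    inj₁ w                                  ∎)
    where open ≡-Reasoning

  restrict : Iso ⟦ G ⟧ ⟦ H ⟧
  restrict = record
    { bij       = mk↔ₛ′ restrict-to γ⁻¹.restrict-to restrict-to∘from restrict-from∘to
    ; edge-pres = restrict-to-adj
    ; edge-refl = λ u v σuv → subst₂ (λ a b → adj G a b ≡ true)
                    (restrict-from∘to u) (restrict-from∘to v)
                    (γ⁻¹.restrict-to-adj _ _ σuv)
    ; col-pres  = restrict-to-col
    }

open GM-Iso using (to-inj₁; clique↦clique)
open GM-Restriction using (restrict)

fixes-vertices⇒id : ∀ {n} (G : ColoredGraph n) (γ : Aut (GM G)) →
                    (∀ v → to γ (inj₁ v) ≡ inj₁ v) → ∀ x → to γ x ≡ x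
fixes-vertices⇒id G γ fixed (inj₁ v) = fixed v
fixes-vertices⇒id G γ fixed (inj₂ C) with clique↦clique G G γ C
... | D , γC≡D = trans γC≡D (cong inj₂ (MaxClique-≡ G (⊆-antisym D⊆C C⊆D)))
  where
  C⊆D : proj₁ C ⊆ proj₁ D
  C⊆D {v} v∈C = subst₂ (GM-E G) (fixed v) γC≡D (edge-pres γ (inj₁ v) (inj₂ C) v∈C)
  D⊆C : proj₁ D ⊆ proj₁ C
  D⊆C {v} v∈D = edge-refl γ (inj₁ v) (inj₂ C) (subst₂ (GM-E G) (sym (fixed v)) (sym γC≡D) v∈D)

mainTheorem16 : ∀ {n m} (G : ColoredGraph n) (H : ColoredGraph m) →
    ((Iso ⟦ G ⟧ ⟦ H ⟧ → Iso (GM G) (GM H)) × (Iso (GM G) (GM H) → Iso ⟦ G ⟧ ⟦ H ⟧))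
    × (∀ (γ : Aut (GM G)) → (∀ v → to γ (inj₁ v) ≡ inj₁ v) → ∀ x → to γ x ≡ x)
    × ((∀ (γ : Aut (GM G)) → ∃ λ (σ : Aut ⟦ G ⟧) → ∀ v → to γ (inj₁ v) ≡ inj₁ (to σ v))
    × (∀ (σ : Aut ⟦ G ⟧) → ∃ λ (γ : Aut (GM G)) → ∀ v → to γ (inj₁ v) ≡ inj₁ (to σ v)))
mainTheorem16 G H =
    (GM-map G H , restrict G H)
  , fixes-vertices⇒id G
  , (λ γ → restrict G G γ , to-inj₁ G G γ)
  , (λ σ → GM-map G G σ , λ v → refl)
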